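{- Let $(L,\vee,\wedge,{\sim},{^*},0,1)$ be a regular pseudocomplemented Kleene algebra defined on an algebraic lattice, let $U=\bigcup\{\langle a\rangle\mid a\in\mathcal{A}\}$, and let $R$ be the tolerance on $U$ induced by the covering $\mathcal{H}=\{\langle a\rangle\mid a\in\mathcal{A}\}$. Let $x,y,z\in U$. (a) If $x\in\mathcal{A}$, then $R(x)=\langle x\rangle$. (b) If $y\in\mathcal{J}\setminus\mathcal{A}$, then $y=g(a)$ for some $a\in\mathcal{A}$ and $R(y)=R(a)=\langle a\rangle$. (c) If $z\in U\setminus\mathcal{J}$, then $R(z)=\langle a\rangle\cup\langle b\rangle$ for some distinct $a,b\in\mathcal{A}$ with $z=a\vee b$.
   Context: A Kleene algebra $(L,\vee,\wedge,{\sim},0,1)$ is a bounded distributive lattice with ${\sim}{\sim}x=x$, $x\le y\iff{\sim}y\le{\sim}x$, and $x\wedge{\sim}x\le y\vee{\sim}y$. It is pseudocomplemented if every $x$ has a pseudocomplement $x^*$ ($x\wedge z=0\iff z\le x^*$); set $x^+:={\sim}(({\sim}x)^*)$; it is regular if $x^*=y^*$ and $x^+=y^+$ imply $x=y$. A lattice is algebraic if complete and each element is a join of compact elements. $\mathcal{J}$ is the set of completely join-irreducible elements of $L$, $\mathcal{A}$ the set of atoms. For $j\in\mathcal{J}$, $g(j)=\bigwedge\{x\in L\mid x\not\le{\sim}j\}\in\mathcal{J}$. For $x,y\in\mathcal{A}$, $x\simeq y\iff x\le g(y)$, and $\langle x\rangle=\{x\vee y\mid y\in\mathcal{A},\ y\simeq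 x\}\cup\{g(x)\}$. The tolerance induced by a covering $\mathcal{H}$ of $U$ is $R=\bigcup\{X\times X\mid X\in\mathcal{H}\}$, and $R(x)=\{y\mid x\,R\,y\}$. -}

module Defs where

open import Level using (0ℓ)
open import Data.Product using (Σ; ∃; ∃-syntax; _×_; _,_)
open import Data.Sum using (_⊎_)
open import Data.List using (List)
open import Data.List.Relation.Unary.All using (All)
open import Data.List.Membership.Propositional using (_∈_)
open import Relation.Nullary using (¬_)
open import Relation.Unary using (Pred; _≐_; _∪_)
open import Relation.Binary.PropositionalEquality using (_≡_; _≢_)
open import Function.Bundles using (_⇔_)
import Algebra.Lattice.Structures as LS

record RegularPKAlgebraOnAlgebraicLattice : Set₁ where
  infixr 6 _∨_
  infixr 7 _∧_
  infix 4 _≤_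
  field
    Carrier : Set
    _∨_ _∧_ : Carrier → Carrier → Carrier
    ~_ _* : Carrier → Carrier
    ⊥ ⊤ : Carrier
    isDistributiveLattice : LS.IsDistributiveLattice {A = Carrier} _≡_ _∨_ _∧_
    ∨-identityˡ : ∀ x → ⊥ ∨ x ≡ x
    ∧-identityˡ : ∀ x → ⊤ ∧ x ≡ x

  _≤_ : Carrier → Carrier → Set
  x ≤ y = x ∧ y ≡ x

  field
    ~-involutive : ∀ x → ~ (~ x) ≡ x
    ~-antitone   : ∀ x y → (x ≤ y) ⇔ (~ y ≤ ~ x)
    kleene       : ∀ x y → x ∧ ~ x ≤ y ∨ ~ y
    pseudocomplement : ∀ x z → (x ∧ z ≡ ⊥) ⇔ (z ≤ x *)

  _⁺ : Carrier → Carrier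
  x ⁺ = ~ ((~ x) *)

  field
    regular : ∀ x y → x * ≡ y * → x ⁺ ≡ y ⁺ → x ≡ y
    ⋁ : Pred Carrier 0ℓ → Carrier
    ⋁-upper : ∀ (S : Pred Carrier 0ℓ) x → S x → x ≤ ⋁ S
    ⋁-least : ∀ (S : Pred Carrier 0ℓ) u → (∀ x → S x → x ≤ u) → ⋁ S ≤ u

  ⋀ : Pred Carrier 0ℓ → Carrier
  ⋀ S = ⋁ (λ y → ∀ x → S x → y ≤ x)

  ListPred : List Carrier → Pred Carrier 0ℓ
  ListPred xs = λ x → x ∈ xs

  Compact : Carrier → Set₁
  Compact c = ∀ (S : Pred Carrier 0ℓ) → c ≤ ⋁ S →
              ∃[ xs ] (All S xs × c ≤ ⋁ (ListPred xs))

  field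
    algebraic : ∀ x → Σ (Pred Carrier 0ℓ) (λ S →
                  (∀ c → S c → Compact c) × x ≡ ⋁ S)

  𝒥 : Carrier → Set₁
  𝒥 j = ∀ (S : Pred Carrier 0ℓ) → j ≡ ⋁ S → S j

  𝒜 : Carrier → Set
  𝒜 x = x ≢ ⊥ × (∀ y → y ≤ x → y ≡ ⊥ ⊎ y ≡ x)

  g : Carrier → Carrier
  g j = ⋀ (λ x → ¬ (x ≤ ~ j))

  _≃_ : Carrier → Carrier → Set
  x ≃ y = x ≤ g y

  ⟨_⟩ : Carrier → Pred Carrier 0ℓ
  ⟨ x ⟩ = (λ w → ∃[ y ] (𝒜 y × y ≃ x × w ≡ x ∨ y)) ∪ (λ w → w ≡ g x)

  U : Pred Carrier 0ℓ
  U w = ∃[ a ] (𝒜 a × ⟨ a ⟩ w)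

  R : Carrier → Carrier → Set
  R x y = ∃[ a ] (𝒜 a × ⟨ a ⟩ x × ⟨ a ⟩ y)

  R[_] : Carrier → Pred Carrier 0ℓ
  R[ x ] = λ y → R x y

-- On an atom a the operator g is the double complement ~ (a *); hence a ≤ g a,
-- g is injective on atoms, and a ≤ g b iff b ≤ g a.  Everything strictly below
-- an atom a (resp. below g a) lies below ⊥ (resp. ~ a), which a (resp. g a)
-- does not; in an algebraic lattice this forces complete join-irreducibility.
-- So an element of U outside 𝒥 is a join a ∨ b of two distinct atoms, and as
-- atoms are join-prime in a distributive lattice, the only blocks containing
-- it are ⟨ a ⟩ and ⟨ b ⟩.
module Submission where

open import Defs
open import Level using (0ℓ)
open import Data.Product using (_×_; ∃-syntax; _,_; proj₂)
open import Data.Sum using (_⊎_; inj₁; inj₂; [_,_]′)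
open import Data.Empty using (⊥-elim)
open import Data.List using (List)
open import Data.List.Relation.Unary.All as All using (All; []; _∷_)
open import Data.List.Relation.Unary.Any as Any using (Any; here; there)
open import Relation.Nullary using (¬_)
open import Relation.Unary using (Pred; _≐_; _∪_; _⊆_)
open import Relation.Unary.Properties using (≐-sym; ≐-trans)
open import Relation.Binary.PropositionalEquality
  using (_≡_; _≢_; refl; sym; trans; cong; subst; module ≡-Reasoning)
open import Function using (_∘_; id)
open import Function.Bundles using (Equivalence)
open import Algebra.Lattice.Bundles using (Lattice)
import Algebra.Lattice.Structures as LatticeStructures
import Algebra.Lattice.Properties.Lattice as LatticeProperties
import Relation.Binary.Lattice as OrderLattice

any⊎all : ∀ {A : Set} {P Q : Pred A 0ℓ} {xs : List A} →
          All (P ∪ Q) xs → Any P xs ⊎ All Q xs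
any⊎all [] = inj₂ []
any⊎all (inj₁ px ∷ _) = inj₁ (here px)
any⊎all (inj₂ qx ∷ pqs) with any⊎all pqs
... | inj₁ any = inj₁ (there any)
... | inj₂ all = inj₂ (qx ∷ all)

module Tolerance (L : RegularPKAlgebraOnAlgebraicLattice) where
  open RegularPKAlgebraOnAlgebraicLattice L
  open LatticeStructures.IsDistributiveLattice isDistributiveLattice
    using (isLattice; ∨-comm; ∧-comm; ∧-distribˡ-∨)
  open Equivalence

  lattice : Lattice 0ℓ 0ℓ
  lattice = record { isLattice = isLattice }

  open LatticeProperties lattice using (∨-idem; ∨-∧-orderTheoreticLattice)

  -- The library orders a lattice by x ≡ x ∧ y, the symmetric form of _≤_ here.
  private module O = OrderLattice.Lattice ∨-∧-orderTheoreticLattice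

  ≤-refl : ∀ {x} → x ≤ x
  ≤-refl = sym O.refl

  ≤-reflexive : ∀ {x y} → x ≡ y → x ≤ y
  ≤-reflexive refl = ≤-refl

  ≤-trans : ∀ {x y z} → x ≤ y → y ≤ z → x ≤ z
  ≤-trans p q = sym (O.trans (sym p) (sym q))

  ≤-antisym : ∀ {x y} → x ≤ y → y ≤ x → x ≡ y
  ≤-antisym p q = O.antisym (sym p) (sym q)

  x≤x∨y : ∀ x y → x ≤ x ∨ y
  x≤x∨y x y = sym (O.x≤x∨y x y)

  ∨-least : ∀ {x y z} → x ≤ z → y ≤ z → x ∨ y ≤ z
  ∨-least p q = sym (O.∨-least (sym p) (sym q))

  x∧y≤x : ∀ x y → x ∧ y ≤ x
  x∧y≤x x y = sym (O.x∧y≤x x y)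

  ∧-greatest : ∀ {x y z} → x ≤ y → x ≤ z → x ≤ y ∧ z
  ∧-greatest p q = sym (O.∧-greatest (sym p) (sym q))

  ⊥≤ : ∀ x → ⊥ ≤ x
  ⊥≤ x = subst (⊥ ≤_) (∨-identityˡ x) (x≤x∨y ⊥ x)

  disjoint-≤-∨ : ∀ {x y z} → x ∧ y ≡ ⊥ → x ≤ y ∨ z → x ≤ z
  disjoint-≤-∨ {x} {y} {z} x∧y≡⊥ x≤y∨z = begin
    x ∧ z                ≡⟨ sym (∨-identityˡ (x ∧ z)) ⟩
    ⊥ ∨ x ∧ z            ≡⟨ cong (_∨ x ∧ z) (sym x∧y≡⊥) ⟩
    x ∧ y ∨ x ∧ z        ≡⟨ sym (∧-distribˡ-∨ x y z) ⟩
    x ∧ (y ∨ z)          ≡⟨ x≤y∨z ⟩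
    x                    ∎
    where open ≡-Reasoning

  ~-antitone⇒ : ∀ {x y} → x ≤ y → ~ y ≤ ~ x
  ~-antitone⇒ {x} {y} = to (~-antitone x y)

  ≤~-swap : ∀ {x y} → x ≤ ~ y → y ≤ ~ x
  ≤~-swap {x} {y} p = subst (_≤ ~ x) (~-involutive y) (~-antitone⇒ p)

  ~≤-swap : ∀ {x y} → ~ x ≤ y → ~ y ≤ x
  ~≤-swap {x} {y} p = subst (~ y ≤_) (~-involutive x) (~-antitone⇒ p)

  disjoint⇒≤* : ∀ {x z} → x ∧ z ≡ ⊥ → z ≤ x *
  disjoint⇒≤* {x} {z} = to (pseudocomplement x z)

  ∧*≡⊥ : ∀ x → x ∧ x * ≡ ⊥
  ∧*≡⊥ x = from (pseudocomplement x (x *)) ≤-refl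

  ⋀-least-element : ∀ (S : Pred Carrier 0ℓ) {x} → S x → (∀ y → S y → x ≤ y) → ⋀ S ≡ x
  ⋀-least-element S {x} Sx x≤S =
    ≤-antisym (⋁-least _ x (λ y y≤S → y≤S x Sx)) (⋁-upper _ x x≤S)

  ⋁-pair : ∀ x y → ⋁ (λ z → z ≡ x ⊎ z ≡ y) ≡ x ∨ y
  ⋁-pair x y = ≤-antisym
    (⋁-least _ _ λ { _ (inj₁ refl) → x≤x∨y x y ; _ (inj₂ refl) → y≤x∨y })
    (∨-least (⋁-upper _ x (inj₁ refl)) (⋁-upper _ y (inj₂ refl)))
    where
    y≤x∨y : y ≤ x ∨ y
    y≤x∨y = subst (y ≤_) (∨-comm y x) (x≤x∨y y x)

  𝒥-join : ∀ {j x y} → 𝒥 j → j ≡ x ∨ y → j ≡ x ⊎ j ≡ y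
  𝒥-join {j} {x} {y} 𝒥j j≡x∨y = 𝒥j _ (trans j≡x∨y (sym (⋁-pair x y)))

  atom-≤⊎disjoint : ∀ {a} → 𝒜 a → ∀ x → a ≤ x ⊎ a ∧ x ≡ ⊥
  atom-≤⊎disjoint {a} (_ , below-a) x with below-a (a ∧ x) (x∧y≤x a x)
  ... | inj₁ a∧x≡⊥ = inj₂ a∧x≡⊥
  ... | inj₂ a∧x≡a = inj₁ a∧x≡a

  atom-≤-atom : ∀ {a c} → 𝒜 a → 𝒜 c → a ≤ c → a ≡ c
  atom-≤-atom (a≢⊥ , _) (_ , below-c) a≤c with below-c _ a≤c
  ... | inj₁ a≡⊥ = ⊥-elim (a≢⊥ a≡⊥)
  ... | inj₂ a≡c = a≡c

  atom≰* : ∀ {a} → 𝒜 a → ¬ a ≤ a *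
  atom≰* {a} (a≢⊥ , _) a≤a* = a≢⊥ (trans (sym a≤a*) (∧*≡⊥ a))

  atom-join-prime : ∀ {a x y} → 𝒜 a → a ≤ x ∨ y → a ≤ x ⊎ a ≤ y
  atom-join-prime {a} {x} 𝒜a a≤x∨y with atom-≤⊎disjoint 𝒜a x
  ... | inj₁ a≤x = inj₁ a≤x
  ... | inj₂ a∧x≡⊥ = inj₂ (disjoint-≤-∨ a∧x≡⊥ a≤x∨y)

  ~*≰~ : ∀ {a} → 𝒜 a → ¬ ~ (a *) ≤ ~ a
  ~*≰~ {a} 𝒜a p = atom≰* 𝒜a (subst (a ≤_) (~-involutive (a *)) (≤~-swap p))

  ≤~⊎~*≤ : ∀ {a} → 𝒜 a → ∀ x → x ≤ ~ a ⊎ ~ (a *) ≤ x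
  ≤~⊎~*≤ 𝒜a x with atom-≤⊎disjoint 𝒜a (~ x)
  ... | inj₁ a≤~x = inj₁ (≤~-swap a≤~x)
  ... | inj₂ a∧~x≡⊥ = inj₂ (~≤-swap (disjoint⇒≤* a∧~x≡⊥))

  -- The Kleene axiom, applied to a * and a, is what puts a below ~ (a *).
  atom≤~* : ∀ {a} → 𝒜 a → a ≤ ~ (a *)
  atom≤~* {a} 𝒜a with atom-≤⊎disjoint 𝒜a (~ (a *))
  ... | inj₁ a≤~a* = a≤~a*
  ... | inj₂ a∧~a*≡⊥ = ⊥-elim (~*≰~ 𝒜a (disjoint-≤-∨ ~a*∧a≡⊥ ~a*≤a∨~a))
    where
    ~a*∧a≡⊥ : ~ (a *) ∧ a ≡ ⊥
    ~a*∧a≡⊥ = trans (∧-comm (~ (a *)) a) a∧~a*≡⊥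
    ~a*≤a∨~a : ~ (a *) ≤ a ∨ ~ a
    ~a*≤a∨~a = ≤-trans (∧-greatest (disjoint⇒≤* a∧~a*≡⊥) ≤-refl) (kleene (a *) a)

  g-atom : ∀ {a} → 𝒜 a → g a ≡ ~ (a *)
  g-atom {a} 𝒜a = ⋀-least-element _ (~*≰~ 𝒜a) ~*≤
    where
    ~*≤ : ∀ x → ¬ x ≤ ~ a → ~ (a *) ≤ x
    ~*≤ x x≰~a = [ ⊥-elim ∘ x≰~a , id ]′ (≤~⊎~*≤ 𝒜a x)

  atom≤g : ∀ {a} → 𝒜 a → a ≤ g a
  atom≤g {a} 𝒜a = subst (a ≤_) (sym (g-atom 𝒜a)) (atom≤~* 𝒜a)

  g-injective : ∀ {a c} → 𝒜 a → 𝒜 c → g a ≡ g c → a ≡ c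
  g-injective {a} {c} 𝒜a 𝒜c ga≡gc with atom-≤⊎disjoint 𝒜a c
  ... | inj₁ a≤c = atom-≤-atom 𝒜a 𝒜c a≤c
  ... | inj₂ a∧c≡⊥ = ⊥-elim (atom≰* 𝒜c (subst (c ≤_) a*≡c* (disjoint⇒≤* a∧c≡⊥)))
    where
    a*≡c* : a * ≡ c *
    a*≡c* = begin
      a *          ≡⟨ sym (~-involutive (a *)) ⟩
      ~ (~ (a *))  ≡⟨ cong ~_ (trans (sym (g-atom 𝒜a)) (trans ga≡gc (g-atom 𝒜c))) ⟩
      ~ (~ (c *))  ≡⟨ ~-involutive (c *) ⟩
      c *          ∎
      where open ≡-Reasoning

  ≃-sym : ∀ {a b} → 𝒜 a → 𝒜 b → a ≃ b → b ≃ a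
  ≃-sym {a} {b} 𝒜a 𝒜b a≤gb with atom-≤⊎disjoint 𝒜b (~ (a *))
  ... | inj₁ b≤~a* = subst (b ≤_) (sym (g-atom 𝒜a)) b≤~a*
  ... | inj₂ b∧~a*≡⊥ = ⊥-elim (~*≰~ 𝒜a (≤-trans (disjoint⇒≤* b∧~a*≡⊥) b*≤~a))
    where
    b*≤~a : b * ≤ ~ a
    b*≤~a = ≤~-swap (subst (a ≤_) (g-atom 𝒜b) a≤gb)

  record StrictDownsetBelow (j m : Carrier) : Set where
    field
      below     : ∀ x → x ≤ j → x ≡ j ⊎ x ≤ m
      not-below : ¬ j ≤ m

  module _ {j m : Carrier} (sdb : StrictDownsetBelow j m) where
    open StrictDownsetBelow sdb

    ∈⋁⇒≤ : ∀ {S} → j ≡ ⋁ S → ∀ {x} → S x → S j ⊎ x ≤ m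
    ∈⋁⇒≤ {S} j≡⋁S {x} Sx with below x (subst (x ≤_) (sym j≡⋁S) (⋁-upper S x Sx))
    ... | inj₁ x≡j = inj₁ (subst S x≡j Sx)
    ... | inj₂ x≤m = inj₂ x≤m

    compact⇒𝒥 : Compact j → 𝒥 j
    compact⇒𝒥 compact S j≡⋁S with compact S (≤-reflexive j≡⋁S)
    ... | xs , xs⊆S , j≤⋁xs with any⊎all (All.map (∈⋁⇒≤ j≡⋁S) xs⊆S)
    ...   | inj₁ some-Sj = proj₂ (Any.satisfied some-Sj)
    ...   | inj₂ all≤m =
      ⊥-elim (not-below (≤-trans j≤⋁xs (⋁-least _ m (λ _ → All.lookup all≤m))))

    -- A generator of j that is not j itself lies below m, so some generator is j.
    ¬¬𝒥 : ¬ ¬ 𝒥 j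
    ¬¬𝒥 ¬𝒥j with algebraic j
    ... | T , compacts , j≡⋁T =
      not-below (subst (_≤ m) (sym j≡⋁T) (⋁-least T m generator≤m))
      where
      generator≤m : ∀ t → T t → t ≤ m
      generator≤m t Tt with below t (subst (t ≤_) (sym j≡⋁T) (⋁-upper T t Tt))
      ... | inj₁ refl = ⊥-elim (¬𝒥j (compact⇒𝒥 (compacts t Tt)))
      ... | inj₂ t≤m = t≤m

  atom-strictDownsetBelow : ∀ {a} → 𝒜 a → StrictDownsetBelow a ⊥
  atom-strictDownsetBelow {a} (a≢⊥ , below-a) = record
    { below     = λ x x≤a →
        [ (λ x≡⊥ → inj₂ (subst (_≤ ⊥) (sym x≡⊥) ≤-refl)) , inj₁ ]′ (below-a x x≤a)
    ; not-below = λ a≤⊥ → a≢⊥ (≤-antisym a≤⊥ (⊥≤ a))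
    }

  g-strictDownsetBelow : ∀ {a} → 𝒜 a → StrictDownsetBelow (g a) (~ a)
  g-strictDownsetBelow {a} 𝒜a = record
    { below     = below
    ; not-below = subst (λ h → ¬ h ≤ ~ a) (sym (g-atom 𝒜a)) (~*≰~ 𝒜a)
    }
    where
    below : ∀ x → x ≤ g a → x ≡ g a ⊎ x ≤ ~ a
    below x x≤ga with ≤~⊎~*≤ 𝒜a x
    ... | inj₁ x≤~a = inj₂ x≤~a
    ... | inj₂ ~a*≤x = inj₁ (≤-antisym x≤ga (subst (_≤ x) (sym (g-atom 𝒜a)) ~a*≤x))

  ⟨⟩-lower : ∀ {c w} → 𝒜 c → ⟨ c ⟩ w → c ≤ w
  ⟨⟩-lower {c} 𝒜c (inj₁ (v , _ , _ , w≡c∨v)) = subst (c ≤_) (sym w≡c∨v) (x≤x∨y c v)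
  ⟨⟩-lower 𝒜c (inj₂ refl) = atom≤g 𝒜c

  atom∈⟨⟩ : ∀ {a} → 𝒜 a → ⟨ a ⟩ a
  atom∈⟨⟩ {a} 𝒜a = inj₁ (a , 𝒜a , atom≤g 𝒜a , sym (∨-idem a))

  ⟨⟩∩𝒥∖𝒜 : ∀ {c y} → 𝒜 c → 𝒥 y → ¬ 𝒜 y → ⟨ c ⟩ y → y ≡ g c
  ⟨⟩∩𝒥∖𝒜 𝒜c 𝒥y ¬𝒜y (inj₁ (v , 𝒜v , _ , y≡c∨v)) with 𝒥-join 𝒥y y≡c∨v
  ... | inj₁ refl = ⊥-elim (¬𝒜y 𝒜c)
  ... | inj₂ refl = ⊥-elim (¬𝒜y 𝒜v)
  ⟨⟩∩𝒥∖𝒜 _ _ _ (inj₂ y≡gc) = y≡gc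

  ⟨⟩∖𝒥 : ∀ {c z} → 𝒜 c → ⟨ c ⟩ z → ¬ 𝒥 z →
         ∃[ b ] (𝒜 b × b ≃ c × c ≢ b × z ≡ c ∨ b)
  ⟨⟩∖𝒥 𝒜c (inj₂ refl) ¬𝒥z = ⊥-elim (¬¬𝒥 (g-strictDownsetBelow 𝒜c) ¬𝒥z)
  ⟨⟩∖𝒥 {c} 𝒜c (inj₁ (b , 𝒜b , b≃c , z≡c∨b)) ¬𝒥z = b , 𝒜b , b≃c , c≢b , z≡c∨b
    where
    c≢b : c ≢ b
    c≢b refl = ¬¬𝒥 (atom-strictDownsetBelow 𝒜c)
                   (subst (λ z → ¬ 𝒥 z) (trans z≡c∨b (∨-idem c)) ¬𝒥z)

  R[]-single-block : ∀ {a y} → 𝒜 a → ⟨ a ⟩ y →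
                     (∀ {c} → 𝒜 c → ⟨ c ⟩ y → c ≡ a) → R[ y ] ≐ ⟨ a ⟩
  R[]-single-block {a} 𝒜a y∈a unique =
    (λ { (c , 𝒜c , y∈c , w∈c) → subst (λ d → ⟨ d ⟩ _) (unique 𝒜c y∈c) w∈c })
    , (λ w∈a → a , 𝒜a , y∈a , w∈a)

  R[]-atom : ∀ {x} → 𝒜 x → R[ x ] ≐ ⟨ x ⟩
  R[]-atom 𝒜x = R[]-single-block 𝒜x (atom∈⟨⟩ 𝒜x) λ 𝒜c x∈c → atom-≤-atom 𝒜c 𝒜x (⟨⟩-lower 𝒜c x∈c)

  R[]-𝒥∖𝒜 : ∀ {a y} → 𝒜 a → 𝒥 y → ¬ 𝒜 y → ⟨ a ⟩ y → R[ y ] ≐ ⟨ a ⟩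
  R[]-𝒥∖𝒜 𝒜a 𝒥y ¬𝒜y y∈a = R[]-single-block 𝒜a y∈a λ 𝒜c y∈c →
    g-injective 𝒜c 𝒜a (trans (sym (⟨⟩∩𝒥∖𝒜 𝒜c 𝒥y ¬𝒜y y∈c)) (⟨⟩∩𝒥∖𝒜 𝒜a 𝒥y ¬𝒜y y∈a))

  R[]-join : ∀ {a b z} → 𝒜 a → 𝒜 b → b ≃ a → z ≡ a ∨ b → R[ z ] ≐ (⟨ a ⟩ ∪ ⟨ b ⟩)
  R[]-join {a} {b} {z} 𝒜a 𝒜b b≃a z≡a∨b = R[z]⊆ , ⊆R[z]
    where
    z∈⟨a⟩ : ⟨ a ⟩ z
    z∈⟨a⟩ = inj₁ (b , 𝒜b , b≃a , z≡a∨b)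
    z∈⟨b⟩ : ⟨ b ⟩ z
    z∈⟨b⟩ = inj₁ (a , 𝒜a , ≃-sym 𝒜b 𝒜a b≃a , trans z≡a∨b (∨-comm a b))
    R[z]⊆ : R[ z ] ⊆ ⟨ a ⟩ ∪ ⟨ b ⟩
    R[z]⊆ (c , 𝒜c , z∈c , w∈c) with atom-join-prime 𝒜c (subst (c ≤_) z≡a∨b (⟨⟩-lower 𝒜c z∈c))
    ... | inj₁ c≤a = inj₁ (subst (λ d → ⟨ d ⟩ _) (atom-≤-atom 𝒜c 𝒜a c≤a) w∈c)
    ... | inj₂ c≤b = inj₂ (subst (λ d → ⟨ d ⟩ _) (atom-≤-atom 𝒜c 𝒜b c≤b) w∈c)
    ⊆R[z] : ⟨ a ⟩ ∪ ⟨ b ⟩ ⊆ R[ z ]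
    ⊆R[z] (inj₁ w∈a) = a , 𝒜a , z∈⟨a⟩ , w∈a
    ⊆R[z] (inj₂ w∈b) = b , 𝒜b , z∈⟨b⟩ , w∈b

corollary4p7 : (L : RegularPKAlgebraOnAlgebraicLattice) →
    let open RegularPKAlgebraOnAlgebraicLattice L in
    (∀ x → U x → 𝒜 x → R[ x ] ≐ ⟨ x ⟩)
    × (∀ y → U y → 𝒥 y → ¬ 𝒜 y →
        ∃[ a ] (𝒜 a × y ≡ g a × R[ y ] ≐ R[ a ] × R[ a ] ≐ ⟨ a ⟩))
    × (∀ z → U z → ¬ 𝒥 z →
        ∃[ a ] ∃[ b ] (𝒜 a × 𝒜 b × a ≢ b × z ≡ a ∨ b × R[ z ] ≐ (⟨ a ⟩ ∪ ⟨ b ⟩)))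
corollary4p7 L = (λ _ _ → R[]-atom) , part-b , part-c
  where
  open RegularPKAlgebraOnAlgebraicLattice L
  open Tolerance L

  part-b : ∀ y → U y → 𝒥 y → ¬ 𝒜 y →
           ∃[ a ] (𝒜 a × y ≡ g a × R[ y ] ≐ R[ a ] × R[ a ] ≐ ⟨ a ⟩)
  part-b y (a , 𝒜a , y∈a) 𝒥y ¬𝒜y =
    a , 𝒜a , ⟨⟩∩𝒥∖𝒜 𝒜a 𝒥y ¬𝒜y y∈a
      , ≐-trans (R[]-𝒥∖𝒜 𝒜a 𝒥y ¬𝒜y y∈a) (≐-sym (R[]-atom 𝒜a)) , R[]-atom 𝒜a

  part-c : ∀ z → U z → ¬ 𝒥 z →
           ∃[ a ] ∃[ b ] (𝒜 a × 𝒜 b × a ≢ b × z ≡ a ∨ b × R[ z ] ≐ (⟨ a ⟩ ∪ ⟨ b ⟩))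
  part-c z (a , 𝒜a , z∈a) ¬𝒥z with ⟨⟩∖𝒥 𝒜a z∈a ¬𝒥z
  ... | b , 𝒜b , b≃a , a≢b , z≡a∨b = a , b , 𝒜a , 𝒜b , a≢b , z≡a∨b , R[]-join 𝒜a 𝒜b b≃a z≡a∨b
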